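{- Let $G$ be a finite simple oriented graph with pebbling assignment $(S_G)$. If the underlying undirected graph of $G$ is (isomorphic to) an induced subgraph of the underlying undirected graph of $[S_G]$, then there exist an oriented graph $H$ and a pebbling assignment $(S_H)$ on $H$ such that $G$ is an oriented subgraph of $H$, $(S_G)$ is the restriction of $(S_H)$ to the vertices of $G$, and $H\cong [S_H]$ as undirected graphs (i.e. their underlying undirected graphs are isomorphic).
   Context: An oriented graph is a directed graph with no loops, no multiple edges and no pair of opposite edges. A pebbling assignment assigns a nonnegative integer number of pebbles to each vertex. A pebbling move along an edge $(v,w)$ (allowed when $v$ has at least two pebbles) removes two pebbles from $v$ and adds one pebble to $w$. The assignment graph $[S_G]$ is the directed graph whose vertices are all assignments obtainable from $(S_G)$ by finite sequences of pebbling moves (including $(S_G)$ itself), with a directed edge from $A$ to $B$ whenever $B$ is obtained from $A$ by a single pebbling move. -}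

module Defs where

open import Data.Nat using (ℕ; suc; _∸_; _≤_)
open import Data.Fin using (Fin)
open import Data.Vec using (Vec; lookup; _[_]%=_)
open import Data.Bool using (Bool; true; false)
open import Data.Product using (Σ; _×_; ∃; ∃-syntax; _,_)
open import Data.Sum using (_⊎_)
open import Relation.Binary.PropositionalEquality using (_≡_)
open import Relation.Binary.Construct.Closure.ReflexiveTransitive using (Star)
open import Function.Bundles using (_⇔_)

record OrientedGraph (n : ℕ) : Set where
  field
    arc       : Fin n → Fin n → Bool
    noLoop    : ∀ v → arc v v ≡ false
    noOpposite : ∀ u v → arc u v ≡ true → arc v u ≡ false
open OrientedGraph public

Adj : ∀ {n} → OrientedGraph n → Fin n → Fin n → Set
Adj G u v = (arc G u v ≡ true) ⊎ (arc G v u ≡ true)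

Assignment : ℕ → Set
Assignment n = Vec ℕ n

moveResult : ∀ {n} → Assignment n → Fin n → Fin n → Assignment n
moveResult A u v = (A [ u ]%= (λ k → k ∸ 2)) [ v ]%= suc

Move : ∀ {n} → OrientedGraph n → Assignment n → Assignment n → Set
Move G A B = ∃[ u ] ∃[ v ] (arc G u v ≡ true × 2 ≤ lookup A u × B ≡ moveResult A u v)

-- Vertices of the assignment graph [S]: assignments reachable from S by finitely many moves.
Reachable : ∀ {n} → OrientedGraph n → Assignment n → Assignment n → Set
Reachable G S A = Star (Move G) S A

MoveAdj : ∀ {n} → OrientedGraph n → Assignment n → Assignment n → Set
MoveAdj G A B = Move G A B ⊎ Move G B A

InducedInAssignmentGraph : ∀ {n} → OrientedGraph n → Assignment n → Set
InducedInAssignmentGraph {n} G S =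
  Σ (Fin n → Assignment n) λ f →
    (∀ u → Reachable G S (f u)) ×
    (∀ u v → f u ≡ f v → u ≡ v) ×
    (∀ u v → Adj G u v ⇔ MoveAdj G (f u) (f v))

UndirIsoAssignmentGraph : ∀ {m} → OrientedGraph m → Assignment m → Set
UndirIsoAssignmentGraph {m} H S =
  Σ (Fin m → Assignment m) λ φ →
    (∀ i → Reachable H S (φ i)) ×
    (∀ i j → φ i ≡ φ j → i ≡ j) ×
    (∀ A → Reachable H S A → ∃[ i ] φ i ≡ A) ×
    (∀ i j → Adj H i j ⇔ MoveAdj H (φ i) (φ j))

OrientedSubgraphVia : ∀ {n m} → OrientedGraph n → OrientedGraph m → (Fin n → Fin m) → Set
OrientedSubgraphVia G H ι =
  (∀ u v → ι u ≡ ι v → u ≡ v) ×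
  (∀ u v → arc G u v ≡ true → arc H (ι u) (ι v) ≡ true)

-- Every pebbling move lowers the total number of pebbles by one, so [S_G] is a finite
-- oriented graph. Take H to be G together with one new vertex for every assignment of
-- [S_G] that is not the image of a vertex of G, give the new vertices no pebbles, and orient
-- every edge at a new vertex as the corresponding edge of [S_G], pointing away from the new
-- vertex when the other end lies in G. No arc leaves G towards a new vertex, so the new
-- vertices never receive pebbles: the moves of H from S_H are exactly the moves of G from
-- S_G, padded by zeros, and [S_H] ≅ [S_G] ≅ H.
module Submission where

open import Defs
open import Data.Bool using (Bool; true; false)
import Data.Bool as Bool
open import Data.Empty using (⊥-elim)
open import Data.Fin using (Fin; zero; suc; _↑ˡ_; _↑ʳ_; splitAt; join)
open import Data.Fin.Properties
  using (any?; splitAt-↑ˡ; splitAt-↑ʳ; splitAt⁻¹-↑ˡ; splitAt⁻¹-↑ʳ; splitAt-join; join-splitAt; ↑ˡ-injective)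
open import Data.List using (List; []; _∷_; filter; map; concat; concatMap; applyUpTo; cartesianProduct; allFin; deduplicate; length)
import Data.List as List
open import Data.List.Membership.Propositional using (_∈_; find; lose)
open import Data.List.Membership.Propositional.Properties
  using (∈-filter⁺; ∈-filter⁻; ∈-map⁺; ∈-concatMap⁺; ∈-concatMap⁻; ∈-concat⁺′; ∈-concat⁻′; ∈-applyUpTo⁺; ∈-applyUpTo⁻; ∈-cartesianProduct⁺; ∈-allFin; ∈-deduplicate⁺; ∈-deduplicate⁻; ∈-lookup)
open import Data.List.Relation.Unary.All as All using ()
open import Data.List.Relation.Unary.AllPairs using (_∷_)
open import Data.List.Relation.Unary.Any using (here; index)
open import Data.List.Relation.Unary.Any.Properties using (lookup-index)
open import Data.List.Relation.Unary.Unique.Propositional using (Unique)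
import Data.List.Relation.Unary.Unique.Propositional.Properties as Unique
open import Data.List.Relation.Unary.Unique.DecPropositional.Properties using (deduplicate-!)
open import Data.Nat using (ℕ; zero; suc; _+_; _∸_; _≤_; _<_; _≤?_; _≟_; s≤s)
open import Data.Nat.Properties using (+-comm; +-assoc; +-suc; +-cancelʳ-≡; m+[n∸m]≡n; m≤m+n; ≤-reflexive; <-irrefl; <-asym)
open import Data.Product using (Σ; _×_; ∃-syntax; _,_; proj₁; proj₂; uncurry)
open import Data.Sum using (_⊎_; inj₁; inj₂; [_,_]′; swap)
import Data.Sum as Sum
open import Data.Vec using (Vec; _∷_; _++_; lookup; replicate; sum; _[_]%=_)
open import Data.Vec.Properties using (≡-dec; lookup-++ˡ; lookup-++ʳ; lookup-replicate; ++-injectiveˡ)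
open import Function using (_∘_)
open import Function.Bundles using (_⇔_; mk⇔; Equivalence)
import Function.Properties.Equivalence as ⇔
open import Data.Sum.Function.Propositional using (_⊎-⇔_)
open import Relation.Binary.Construct.Closure.ReflexiveTransitive using (ε; _◅_; _◅◅_; gmap)
open import Relation.Binary.PropositionalEquality using (_≡_; refl; sym; trans; cong; subst; module ≡-Reasoning)
open import Relation.Nullary using (¬_; Dec; yes; no; does; ¬?; _×-dec_; _⊎-dec_)
open import Relation.Nullary.Decidable using (dec-false)

does≡true⇔ : ∀ {P : Set} (P? : Dec P) → (does P? ≡ true) ⇔ P
does≡true⇔ (yes p) = mk⇔ (λ _ → p) (λ _ → refl)
does≡true⇔ (no ¬p) = mk⇔ (λ ()) (⊥-elim ∘ ¬p)

Unique-lookup-injective : ∀ {A : Set} {xs : List A} → Unique xs →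
  ∀ i j → List.lookup xs i ≡ List.lookup xs j → i ≡ j
Unique-lookup-injective (_ ∷ _)   zero    zero    _  = refl
Unique-lookup-injective (x∉ ∷ _)  zero    (suc j) eq = ⊥-elim (All.lookup x∉ (∈-lookup j) eq)
Unique-lookup-injective (x∉ ∷ _)  (suc i) zero    eq = ⊥-elim (All.lookup x∉ (∈-lookup i) (sym eq))
Unique-lookup-injective (_ ∷ xs!) (suc i) (suc j) eq = cong suc (Unique-lookup-injective xs! i j eq)

sum-updateAt : ∀ {n} (xs : Vec ℕ n) i (g : ℕ → ℕ) →
  sum (xs [ i ]%= g) + lookup xs i ≡ sum xs + g (lookup xs i)
sum-updateAt (x ∷ xs) zero g = begin
  g x + sum xs + x   ≡⟨ +-comm (g x + sum xs) x ⟩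
  x + (g x + sum xs) ≡⟨ cong (x +_) (+-comm (g x) (sum xs)) ⟩
  x + (sum xs + g x) ≡⟨ +-assoc x (sum xs) (g x) ⟨
  x + sum xs + g x   ∎
  where open ≡-Reasoning
sum-updateAt (x ∷ xs) (suc i) g = begin
  x + sum (xs [ i ]%= g) + lookup xs i   ≡⟨ +-assoc x _ _ ⟩
  x + (sum (xs [ i ]%= g) + lookup xs i) ≡⟨ cong (x +_) (sum-updateAt xs i g) ⟩
  x + (sum xs + g (lookup xs i))         ≡⟨ +-assoc x _ _ ⟨
  x + sum xs + g (lookup xs i)           ∎
  where open ≡-Reasoning

updateAt-++ˡ : ∀ {A : Set} {m n} (xs : Vec A m) (ys : Vec A n) i (g : A → A) →
  (xs ++ ys) [ i ↑ˡ n ]%= g ≡ (xs [ i ]%= g) ++ ys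
updateAt-++ˡ (x ∷ xs) ys zero    g = refl
updateAt-++ˡ (x ∷ xs) ys (suc i) g = cong (x ∷_) (updateAt-++ˡ xs ys i g)

data SplitView (m n : ℕ) : Fin (m + n) → Set where
  left  : (i : Fin m) → SplitView m n (i ↑ˡ n)
  right : (j : Fin n) → SplitView m n (m ↑ʳ j)

splitView : ∀ m {n} (i : Fin (m + n)) → SplitView m n i
splitView m {n} i with splitAt m {n} i in eq
... | inj₁ i′ with refl ← splitAt⁻¹-↑ˡ eq = left i′
... | inj₂ j  with refl ← splitAt⁻¹-↑ʳ eq = right j

sum-moveResult : ∀ {n} (A : Assignment n) u v → 2 ≤ lookup A u →
  suc (sum (moveResult A u v)) ≡ sum A
sum-moveResult A u v 2≤a = begin
  suc (sum (moveResult A u v)) ≡⟨ cong suc added ⟩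
  2 + sum A′                   ≡⟨ +-comm 2 (sum A′) ⟩
  sum A′ + 2                   ≡⟨ removed ⟩
  sum A                        ∎
  where
  open ≡-Reasoning
  A′ = A [ u ]%= (_∸ 2)
  a = lookup A u
  added : sum (moveResult A u v) ≡ suc (sum A′)
  added = +-cancelʳ-≡ (lookup A′ v) _ _ (trans (sum-updateAt A′ v suc) (+-suc (sum A′) _))
  removed : sum A′ + 2 ≡ sum A
  removed = +-cancelʳ-≡ (a ∸ 2) _ _ (begin
    sum A′ + 2 + (a ∸ 2)   ≡⟨ +-assoc (sum A′) 2 (a ∸ 2) ⟩
    sum A′ + (2 + (a ∸ 2)) ≡⟨ cong (sum A′ +_) (m+[n∸m]≡n 2≤a) ⟩
    sum A′ + a             ≡⟨ sum-updateAt A u (_∸ 2) ⟩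
    sum A + (a ∸ 2)        ∎)

module _ {n : ℕ} (G : OrientedGraph n) where

  Move⇒sum≡suc : ∀ {A B} → Move G A B → suc (sum B) ≡ sum A
  Move⇒sum≡suc {A} (u , v , _ , 2≤a , refl) = sum-moveResult A u v 2≤a

  Move⇒sum< : ∀ {A B} → Move G A B → sum B < sum A
  Move⇒sum< mv = ≤-reflexive (Move⇒sum≡suc mv)

  Move-irreflexive : ∀ {A} → ¬ Move G A A
  Move-irreflexive mv = <-irrefl refl (Move⇒sum< mv)

  Move-asymmetric : ∀ {A B} → Move G A B → ¬ Move G B A
  Move-asymmetric AB BA = <-asym (Move⇒sum< AB) (Move⇒sum< BA)

  Move? : ∀ A B → Dec (Move G A B)
  Move? A B = any? λ u → any? λ v →
    (arc G u v Bool.≟ true) ×-dec (2 ≤? lookup A u) ×-dec ≡-dec _≟_ B (moveResult A u v)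

  MoveAdj? : ∀ A B → Dec (MoveAdj G A B)
  MoveAdj? A B = Move? A B ⊎-dec Move? B A

  moveResults : Assignment n → List (Assignment n)
  moveResults A = map (uncurry (moveResult A)) (cartesianProduct (allFin n) (allFin n))

  successors : Assignment n → List (Assignment n)
  successors A = filter (Move? A) (moveResults A)

  ∈-successors⇔ : ∀ {A B} → B ∈ successors A ⇔ Move G A B
  ∈-successors⇔ {A} = mk⇔ (proj₂ ∘ ∈-filter⁻ (Move? A) {xs = moveResults A}) λ where
    mv@(u , v , _ , _ , refl) →
      ∈-filter⁺ (Move? A) (∈-map⁺ (uncurry (moveResult A)) (∈-cartesianProduct⁺ (∈-allFin u) (∈-allFin v))) mv

  layer : Assignment n → ℕ → List (Assignment n)
  layer S zero    = S ∷ []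
  layer S (suc j) = concatMap successors (layer S j)

  ∈-layer⇒ : ∀ {S A} j → A ∈ layer S j → Reachable G S A × j + sum A ≡ sum S
  ∈-layer⇒ zero (here refl) = ε , refl
  ∈-layer⇒ {S} {A} (suc j) A∈ with find (∈-concatMap⁻ successors {xs = layer S j} A∈)
  ... | C , C∈ , A∈succ with ∈-layer⇒ j C∈
  ... | S↝C , j+C≡S = S↝C ◅◅ (mv ◅ ε) , (begin
    suc j + sum A   ≡⟨ +-suc j (sum A) ⟨
    j + suc (sum A) ≡⟨ cong (j +_) (Move⇒sum≡suc mv) ⟩
    j + sum C       ≡⟨ j+C≡S ⟩
    sum S           ∎)
    where
    open ≡-Reasoning
    mv = Equivalence.to ∈-successors⇔ A∈succ

  Reachable⇒∈layer : ∀ {S C A} j → Reachable G C A → C ∈ layer S j → ∃[ j′ ] A ∈ layer S j′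
  Reachable⇒∈layer j ε             C∈ = j , C∈
  Reachable⇒∈layer j (mv ◅ C′↝A) C∈ =
    Reachable⇒∈layer (suc j) C′↝A (∈-concatMap⁺ successors (lose C∈ (Equivalence.from ∈-successors⇔ mv)))

  -- Every move removes a pebble, so no assignment needs more than sum S moves.
  reachables : Assignment n → List (Assignment n)
  reachables S = concat (applyUpTo (layer S) (suc (sum S)))

  ∈-reachables⇔ : ∀ {S A} → A ∈ reachables S ⇔ Reachable G S A
  ∈-reachables⇔ {S} {A} = mk⇔ to from
    where
    to : A ∈ reachables S → Reachable G S A
    to A∈ with ∈-concat⁻′ (applyUpTo (layer S) (suc (sum S))) A∈
    ... | _ , A∈xs , xs∈ with ∈-applyUpTo⁻ (layer S) xs∈
    ... | j , _ , refl = proj₁ (∈-layer⇒ j A∈xs)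
    from : Reachable G S A → A ∈ reachables S
    from S↝A with j , A∈ ← Reachable⇒∈layer 0 S↝A (here refl) =
      ∈-concat⁺′ A∈ (∈-applyUpTo⁺ (layer S) (s≤s j≤S))
      where
      j≤S : j ≤ sum S
      j≤S = subst (j ≤_) (proj₂ (∈-layer⇒ j A∈)) (m≤m+n j (sum A))

module Padding {n k : ℕ} (G : OrientedGraph n) (H : OrientedGraph (n + k))
  (arc-↑ˡ : ∀ u v → arc H (u ↑ˡ k) (v ↑ˡ k) ≡ arc G u v)
  (no-arc-↑ˡ-↑ʳ : ∀ u y → arc H (u ↑ˡ k) (n ↑ʳ y) ≡ false) where

  pad : Assignment n → Assignment (n + k)
  pad A = A ++ replicate k 0

  pad-injective : ∀ {A B} → pad A ≡ pad B → A ≡ B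
  pad-injective {A} {B} = ++-injectiveˡ A B

  lookup-pad-↑ˡ : ∀ A u → lookup (pad A) (u ↑ˡ k) ≡ lookup A u
  lookup-pad-↑ˡ A = lookup-++ˡ A (replicate k 0)

  lookup-pad-↑ʳ : ∀ A y → lookup (pad A) (n ↑ʳ y) ≡ 0
  lookup-pad-↑ʳ A y = trans (lookup-++ʳ A (replicate k 0) y) (lookup-replicate y 0)

  moveResult-pad : ∀ A u v → moveResult (pad A) (u ↑ˡ k) (v ↑ˡ k) ≡ pad (moveResult A u v)
  moveResult-pad A u v = begin
    (pad A [ u ↑ˡ k ]%= (_∸ 2)) [ v ↑ˡ k ]%= suc        ≡⟨ cong (_[ v ↑ˡ k ]%= suc) (updateAt-++ˡ A _ u (_∸ 2)) ⟩
    pad (A [ u ]%= (_∸ 2)) [ v ↑ˡ k ]%= suc              ≡⟨ updateAt-++ˡ (A [ u ]%= (_∸ 2)) _ v suc ⟩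
    pad (moveResult A u v)                               ∎
    where open ≡-Reasoning

  Move-pad : ∀ {A B} → Move G A B → Move H (pad A) (pad B)
  Move-pad {A} (u , v , uv , 2≤a , refl) =
    u ↑ˡ k , v ↑ˡ k , trans (arc-↑ˡ u v) uv ,
    subst (2 ≤_) (sym (lookup-pad-↑ˡ A u)) 2≤a , sym (moveResult-pad A u v)

  -- A move from a padded assignment starts at an old vertex, as new ones carry no
  -- pebbles, and so it also ends at one.
  Move-unpad : ∀ {A C} → Move H (pad A) C → ∃[ B ] Move G A B × C ≡ pad B
  Move-unpad {A} (i , j , ij , 2≤a , C≡) with splitView n i | splitView n j
  ... | right y | _ with () ← subst (2 ≤_) (lookup-pad-↑ʳ A y) 2≤a
  ... | left u | right y with () ← trans (sym ij) (no-arc-↑ˡ-↑ʳ u y)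
  ... | left u | left v =
    moveResult A u v ,
    (u , v , trans (sym (arc-↑ˡ u v)) ij , subst (2 ≤_) (lookup-pad-↑ˡ A u) 2≤a , refl) ,
    trans C≡ (moveResult-pad A u v)

  Move-pad⁻¹ : ∀ {A B} → Move H (pad A) (pad B) → Move G A B
  Move-pad⁻¹ mv with _ , AB , eq ← Move-unpad mv with refl ← pad-injective eq = AB

  MoveAdj-pad⇔ : ∀ {A B} → MoveAdj H (pad A) (pad B) ⇔ MoveAdj G A B
  MoveAdj-pad⇔ = mk⇔ (Sum.map Move-pad⁻¹ Move-pad⁻¹) (Sum.map Move-pad Move-pad)

  Reachable-pad : ∀ {A B} → Reachable G A B → Reachable H (pad A) (pad B)
  Reachable-pad = gmap pad Move-pad

  Reachable-unpad : ∀ {A C} → Reachable H (pad A) C → ∃[ B ] Reachable G A B × C ≡ pad B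
  Reachable-unpad {A} ε = A , ε , refl
  Reachable-unpad (mv ◅ rest) with Move-unpad mv
  ... | _ , AB , refl with Reachable-unpad rest
  ... | B , A′↝B , eq = B , AB ◅ A′↝B , eq

module Completion {n : ℕ} (G : OrientedGraph n) (S : Assignment n)
  (f : Fin n → Assignment n) (f-reachable : ∀ u → Reachable G S (f u))
  (f-injective : ∀ u v → f u ≡ f v → u ≡ v)
  (f-adj : ∀ u v → Adj G u v ⇔ MoveAdj G (f u) (f v)) where

  InImage : Assignment n → Set
  InImage A = ∃[ u ] f u ≡ A

  InImage? : ∀ A → Dec (InImage A)
  InImage? A = any? λ u → ≡-dec _≟_ (f u) A

  others : List (Assignment n)
  others = filter (¬? ∘ InImage?) (deduplicate (≡-dec _≟_) (reachables G S))

  others-unique : Unique others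
  others-unique = Unique.filter⁺ (¬? ∘ InImage?) (deduplicate-! (≡-dec _≟_) (reachables G S))

  ∈-others⁻ : ∀ {A} → A ∈ others → Reachable G S A × ¬ InImage A
  ∈-others⁻ A∈ with A∈dedup , A∉f ← ∈-filter⁻ (¬? ∘ InImage?) {xs = deduplicate (≡-dec _≟_) (reachables G S)} A∈ =
    Equivalence.to (∈-reachables⇔ G) (∈-deduplicate⁻ (≡-dec _≟_) (reachables G S) A∈dedup) , A∉f

  ∈-others⁺ : ∀ {A} → Reachable G S A → ¬ InImage A → A ∈ others
  ∈-others⁺ S↝A A∉f =
    ∈-filter⁺ (¬? ∘ InImage?) (∈-deduplicate⁺ (≡-dec _≟_) (Equivalence.from (∈-reachables⇔ G) S↝A)) A∉f

  k : ℕ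
  k = length others

  other : Fin k → Assignment n
  other = List.lookup others

  label : Fin n ⊎ Fin k → Assignment n
  label = [ f , other ]′

  label-reachable : ∀ s → Reachable G S (label s)
  label-reachable (inj₁ u) = f-reachable u
  label-reachable (inj₂ y) = proj₁ (∈-others⁻ (∈-lookup y))

  label-injective : ∀ s t → label s ≡ label t → s ≡ t
  label-injective (inj₁ u) (inj₁ v) eq = cong inj₁ (f-injective u v eq)
  label-injective (inj₁ u) (inj₂ y) eq = ⊥-elim (proj₂ (∈-others⁻ (∈-lookup y)) (u , eq))
  label-injective (inj₂ x) (inj₁ v) eq = ⊥-elim (proj₂ (∈-others⁻ (∈-lookup x)) (v , sym eq))
  label-injective (inj₂ x) (inj₂ y) eq = cong inj₂ (Unique-lookup-injective others-unique x y eq)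

  label-surjective : ∀ {A} → Reachable G S A → ∃[ s ] label s ≡ A
  label-surjective {A} S↝A with InImage? A
  ... | yes (u , fu≡A) = inj₁ u , fu≡A
  ... | no A∉f         = inj₂ (index A∈) , sym (lookup-index A∈)
    where
    A∈ : A ∈ others
    A∈ = ∈-others⁺ S↝A A∉f

  arcL : Fin n ⊎ Fin k → Fin n ⊎ Fin k → Bool
  arcL (inj₁ u) (inj₁ v) = arc G u v
  arcL (inj₁ _) (inj₂ _) = false
  arcL (inj₂ x) (inj₁ v) = does (MoveAdj? G (other x) (f v))
  arcL (inj₂ x) (inj₂ y) = does (Move? G (other x) (other y))

  arcL-noLoop : ∀ s → arcL s s ≡ false
  arcL-noLoop (inj₁ u) = noLoop G u
  arcL-noLoop (inj₂ x) = dec-false (Move? G (other x) (other x)) (Move-irreflexive G)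

  arcL-noOpposite : ∀ s t → arcL s t ≡ true → arcL t s ≡ false
  arcL-noOpposite (inj₁ u) (inj₁ v) st = noOpposite G u v st
  arcL-noOpposite (inj₂ x) (inj₁ v) _  = refl
  arcL-noOpposite (inj₂ x) (inj₂ y) st =
    dec-false (Move? G (other y) (other x))
      (Move-asymmetric G (Equivalence.to (does≡true⇔ (Move? G (other x) (other y))) st))

  AdjL⇔ : ∀ s t → (arcL s t ≡ true ⊎ arcL t s ≡ true) ⇔ MoveAdj G (label s) (label t)
  AdjL⇔ (inj₁ u) (inj₁ v) = f-adj u v
  AdjL⇔ (inj₁ u) (inj₂ y) = mk⇔ [ (λ ()) , swap ∘ Equivalence.to yu ]′ (inj₂ ∘ Equivalence.from yu ∘ swap)
    where yu = does≡true⇔ (MoveAdj? G (other y) (f u))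
  AdjL⇔ (inj₂ x) (inj₁ v) = mk⇔ [ Equivalence.to xv , (λ ()) ]′ (inj₁ ∘ Equivalence.from xv)
    where xv = does≡true⇔ (MoveAdj? G (other x) (f v))
  AdjL⇔ (inj₂ x) (inj₂ y) = does≡true⇔ (Move? G (other x) (other y)) ⊎-⇔ does≡true⇔ (Move? G (other y) (other x))

  H : OrientedGraph (n + k)
  H = record
    { arc        = λ i j → arcL (splitAt n i) (splitAt n j)
    ; noLoop     = λ i → arcL-noLoop (splitAt n i)
    ; noOpposite = λ i j → arcL-noOpposite (splitAt n i) (splitAt n j)
    }

  arc-↑ˡ : ∀ u v → arc H (u ↑ˡ k) (v ↑ˡ k) ≡ arc G u v
  arc-↑ˡ u v rewrite splitAt-↑ˡ n u k | splitAt-↑ˡ n v k = refl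

  no-arc-↑ˡ-↑ʳ : ∀ u y → arc H (u ↑ˡ k) (n ↑ʳ y) ≡ false
  no-arc-↑ˡ-↑ʳ u y rewrite splitAt-↑ˡ n u k | splitAt-↑ʳ n k y = refl

  open Padding G H arc-↑ˡ no-arc-↑ˡ-↑ʳ public

  φ : Fin (n + k) → Assignment (n + k)
  φ i = pad (label (splitAt n i))

  φ-injective : ∀ i j → φ i ≡ φ j → i ≡ j
  φ-injective i j eq = begin
    i                      ≡⟨ join-splitAt n k i ⟨
    join n k (splitAt n i) ≡⟨ cong (join n k) (label-injective (splitAt n i) (splitAt n j) (pad-injective eq)) ⟩
    join n k (splitAt n j) ≡⟨ join-splitAt n k j ⟩
    j                      ∎
    where open ≡-Reasoning

  φ-surjective : ∀ A → Reachable H (pad S) A → ∃[ i ] φ i ≡ A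
  φ-surjective A S↝A with Reachable-unpad S↝A
  ... | B , S↝B , refl with label-surjective S↝B
  ... | s , refl = join n k s , cong (pad ∘ label) (splitAt-join n k s)

  H≅[pad-S] : UndirIsoAssignmentGraph H (pad S)
  H≅[pad-S] =
    φ , (λ i → Reachable-pad (label-reachable (splitAt n i))) , φ-injective , φ-surjective ,
    λ i j → ⇔.trans (AdjL⇔ (splitAt n i) (splitAt n j)) (⇔.sym MoveAdj-pad⇔)

theorem8p1 : (n : ℕ) (G : OrientedGraph n) (SG : Assignment n) →
    InducedInAssignmentGraph G SG →
    ∃[ m ] Σ (OrientedGraph m) λ H → Σ (Assignment m) λ SH →
      Σ (Fin n → Fin m) λ ι →
        OrientedSubgraphVia G H ι ×
        (∀ v → lookup SG v ≡ lookup SH (ι v)) ×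
        UndirIsoAssignmentGraph H SH
theorem8p1 n G SG (f , f-reachable , f-injective , f-adj) =
  n + k , H , pad SG , _↑ˡ k ,
  (↑ˡ-injective k , λ u v uv → trans (arc-↑ˡ u v) uv) ,
  (λ v → sym (lookup-pad-↑ˡ SG v)) ,
  H≅[pad-S]
  where open Completion G SG f f-reachable f-injective f-adj
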